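{- Let $n\ge2$ and use the notation of the context. Then the kernel $I^{fflv}$ of $\psi$ coincides with the kernel $I^{V_o,V_c}(\mathcal N)$ of $\theta$.
   Context: $R$ is the polynomial ring over $\mathbb{C}$ in the Plücker variables $X_{i_1,\ldots,i_k}$, $1\le k\le n-1$, $1\le i_1<\dots<i_k\le n$; for arbitrary distinct indices set $X_{i_{\sigma(1)},\ldots,i_{\sigma(k)}}=\mathrm{sgn}(\sigma)X_{i_1,\ldots,i_k}$. A one-column tableau $(\alpha_1,\ldots,\alpha_k)$ with entries in $[1,n]$ is PBW-semistandard if $\alpha_r\le k$ implies $\alpha_r=r$, and $r_1<r_2$, $\alpha_{r_1}>k$, $\alpha_{r_2}>k$ imply $\alpha_{r_1}>\alpha_{r_2}$. For each set $\{i_1<\dots<i_k\}$ there is exactly one such tableau with these entries; $\mathcal N$ is the set of symbols $b_{\alpha_1,\ldots,\alpha_k}$ over these tableaux, and $X_{b_{\alpha_1,\ldots,\alpha_k}}:=X_{\alpha_1,\ldots,\alpha_k}$. Let $P=\{(r,s):1\le r\le s\le n\}\setminus\{(1,1),(n,n)\}$ with $(r,s)\le(u,v)$ iff $r\le u$, $s\le v$. For an order ideal (lower set) $J$ of $P$ let $b(J)=b_{\alpha_1,\ldots,\alpha_k}$ where $k$ is the largest $l$ with $(l,l)\in J$ ($k=1$ if none), $\alpha_s=t$ for each maximal element $(s,t)$ of $J$, and $\alpha_r=r$ otherwise; $J\mapsto b(J)$ is a bijection from order ideals of $P$ onto $\mathcal N$, with inverse $\iota$. Let $V_o=\{(i,i):2\le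 i\le n-1\}$, $V_c=\{(r,s)\in P:r<s\}$, and for an order ideal $J$ let $K(J)=(J\cap V_o)\cup\{$maximal elements of $J$ lying in $V_c\}$. $\theta:R\to\mathbb{C}[z_p\,(p\in P),t]$ is $X_b\mapsto t\prod_{p\in K(\iota(b))}z_p$, and $I^{V_o,V_c}(\mathcal N)=\ker\theta$. $\psi:R\to\mathbb{C}[z_{i,j}\,(1\le i<j\le n),z_k\,(1\le k\le n-1)]$ sends $X_{\alpha_1,\ldots,\alpha_k}$, for $b_{\alpha_1,\ldots,\alpha_k}\in\mathcal N$, to $z_k\prod_{j:\alpha_j>k}z_{j,\alpha_j}$, and $I^{fflv}=\ker\psi$. -}

module Defs where

open import Level using (Level)
open import Data.Nat using (ℕ; zero; suc; _≤ᵇ_; _<ᵇ_; _≡ᵇ_; _⊔_; _∸_)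
open import Data.Bool using (Bool; true; false; _∧_; _∨_; not; if_then_else_; T)
open import Data.Vec using (Vec; []; _∷_)
open import Data.List using (List; []; _∷_; map; upTo; foldr; concatMap; filterᵇ; _++_; length; zip)
open import Data.Product using (Σ; _×_; _,_; proj₁; proj₂)
open import Algebra.Bundles using (CommutativeRing)

range : ℕ → List ℕ
range n = map suc (upTo n)

-- 1-based lookup in a Bool vector, false out of range
at : ∀ {m} → Vec Bool m → ℕ → Bool
at [] _ = false
at (x ∷ xs) zero = false
at (x ∷ xs) (suc zero) = x
at (x ∷ xs) (suc (suc i)) = at xs (suc i)

atV : ∀ {m k} → Vec (Vec Bool k) m → ℕ → Vec Bool k
atV {k = k} [] _ = Data.Vec.replicate k false
atV (x ∷ xs) zero = Data.Vec.replicate _ false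
atV (x ∷ xs) (suc zero) = x
atV (x ∷ xs) (suc (suc i)) = atV xs (suc i)

allᵇ : {A : Set} → (A → Bool) → List A → Bool
allᵇ p [] = true
allᵇ p (x ∷ xs) = p x ∧ allᵇ p xs

_⇒ᵇ_ : Bool → Bool → Bool
a ⇒ᵇ b = not a ∨ b

inP : ℕ → ℕ → ℕ → Bool
inP n r s = (1 ≤ᵇ r) ∧ (r ≤ᵇ s) ∧ (s ≤ᵇ n)
          ∧ not ((r ≡ᵇ 1) ∧ (s ≡ᵇ 1)) ∧ not ((r ≡ᵇ n) ∧ (s ≡ᵇ n))

-- A subset of [1,n]×[1,n] as an n×n Boolean grid (canonical representation);
-- entry (r,s) (1-based) is true iff (r,s) ∈ J.
Grid : ℕ → Set
Grid n = Vec (Vec Bool n) n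

mem : ∀ {n} → Grid n → ℕ → ℕ → Bool
mem J r s = at (atV J r) s

isOrderIdeal : (n : ℕ) → Grid n → Bool
isOrderIdeal n J =
  allᵇ (λ r → allᵇ (λ s → mem J r s ⇒ᵇ inP n r s) (range n)) (range n)
  ∧ allᵇ (λ r → allᵇ (λ s → allᵇ (λ u → allᵇ (λ v →
      (mem J u v ∧ inP n r s ∧ (r ≤ᵇ u) ∧ (s ≤ᵇ v)) ⇒ᵇ mem J r s)
      (range n)) (range n)) (range n)) (range n)

-- Order ideals of P.  The proof component lives in T (…), which is ⊤ or ⊥,
-- so every order ideal has exactly one representative.
OrderIdeal : ℕ → Set
OrderIdeal n = Σ (Grid n) (λ J → T (isOrderIdeal n J))

isMax : ∀ {n} → Grid n → ℕ → ℕ → Bool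
isMax {n} J r s = mem J r s ∧
  allᵇ (λ u → allᵇ (λ v → (mem J u v ∧ (r ≤ᵇ u) ∧ (s ≤ᵇ v)) ⇒ᵇ ((u ≡ᵇ r) ∧ (v ≡ᵇ s)))
    (range n)) (range n)

-- k = largest l with (l,l) ∈ J, and 1 if there is none
kOf : ∀ {n} → Grid n → ℕ
kOf {n} J = foldr (λ l acc → if mem J l l then l ⊔ acc else acc) 1 (range n)

entryOf : ∀ {n} → Grid n → ℕ → ℕ
entryOf {n} J r = foldr (λ t acc → if isMax J r t then t else acc) r (range n)

alphaOf : ∀ {n} → Grid n → List ℕ
alphaOf J = map (entryOf J) (range (kOf J))

data TVar : Set where
  zV : ℕ → ℕ → TVar   -- z_{r,s}: z_p for p = (r,s) ∈ P (for θ), z_{i,j} (for ψ)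
  zK : ℕ → TVar
  tV : TVar

_=ᵗ_ : TVar → TVar → Bool
zV a b =ᵗ zV c d = (a ≡ᵇ c) ∧ (b ≡ᵇ d)
zK a =ᵗ zK b = a ≡ᵇ b
tV =ᵗ tV = true
_ =ᵗ _ = false

count : TVar → List TVar → ℕ
count x [] = 0
count x (y ∷ ys) = if x =ᵗ y then suc (count x ys) else count x ys

-- monomials (multisets of variables, as lists) are equal iff every variable
-- occurs with the same multiplicity
sameMon : List TVar → List TVar → Bool
sameMon u v = allᵇ (λ x → count x u ≡ᵇ count x v) (u ++ v)

-- The maps on generators.  The generator X_{b(J)} of R is indexed by the
-- order ideal J = ι(b(J)) (J ↦ b(J) is a bijection onto 𝒩).

-- θ(X_b) = t · ∏_{p ∈ K(ι b)} z_p,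
-- K(J) = (J ∩ V_o) ∪ {maximal elements of J in V_c}
Kset : ∀ {n} → Grid n → List (ℕ × ℕ)
Kset {n} J = filterᵇ ok (concatMap (λ r → map (λ s → r , s) (range n)) (range n))
  where
  ok : ℕ × ℕ → Bool
  ok (r , s) = ((r ≡ᵇ s) ∧ (2 ≤ᵇ r) ∧ (r ≤ᵇ n ∸ 1) ∧ mem J r s)
             ∨ ((r <ᵇ s) ∧ inP n r s ∧ isMax J r s)

θgen : (n : ℕ) → OrderIdeal n → List TVar
θgen n (J , _) = tV ∷ map (λ p → zV (proj₁ p) (proj₂ p)) (Kset J)

ψgen : (n : ℕ) → OrderIdeal n → List TVar
ψgen n (J , _) =
  zK k ∷ map (λ p → zV (proj₁ p) (proj₂ p))
              (filterᵇ (λ p → k <ᵇ proj₂ p) (zip (range (length α)) α))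
  where
  k = kOf J
  α = alphaOf J

module _ {c ℓ : Level} (K : CommutativeRing c ℓ) where
  open CommutativeRing K

  -- A polynomial in the generators (indexed by V) with coefficients in K,
  -- as a finite list of terms (coefficient, monomial as a list of generators).
  Poly : Set → Set c
  Poly V = List (Carrier × List V)

  coeffImg : {V : Set} → (V → List TVar) → Poly V → List TVar → Carrier
  coeffImg img [] u = 0#
  coeffImg img ((a , m) ∷ p) u =
    (if sameMon (concatMap img m) u then a else 0#) + coeffImg img p u

  InKer : {V : Set} → (V → List TVar) → Poly V → Set ℓ
  InKer img p = ∀ (u : List TVar) → coeffImg img p u ≈ 0#

-- Both θ and ψ send each generator to a monomial, so a polynomial lies in the kernel of either
-- map iff its coefficients cancel on every fibre; the kernels therefore agree as soon as two
-- monomials in the generators have equal ψ-images exactly when they have equal θ-images.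
-- For a generator with order ideal J and k = k(J), both images contain the same off-diagonal
-- variables: the maximal elements (r, s), r < s, of J are exactly the pairs (r, α_r) with
-- r ≤ k < α_r. Besides these, ψ contributes z_k and θ contributes t z_{2,2} ⋯ z_{k,k}. So on
-- a monomial ψ records how many generators have each value of k, and θ how many have k ≥ i for
-- each i (t counting all of them, as k ≥ 1); either count determines the other.

module Submission where

open import Defs
open import Level using (Level)
open import Algebra.Bundles using (CommutativeRing)
open import Data.Bool using (Bool; true; false; _∧_; _∨_; not; if_then_else_; T)
open import Data.Bool.Properties using (T-∧; T-∨; T-≡; T-not-≡; ∧-assoc; ∧-identityʳ; ∧-zeroʳ)
open import Data.Empty using (⊥-elim)
open import Data.List using (List; []; _∷_; [_]; _++_; map; concatMap; filterᵇ; foldr; length; upTo; zip)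
open import Data.List.Properties using (map-++; upTo-∷ʳ; length-map; length-upTo)
open import Data.List.Membership.Propositional using (_∈_)
open import Data.List.Membership.Propositional.Properties
  using (∈-map⁺; ∈-map⁻; ∈-upTo⁺; ∈-upTo⁻; ∈-++⁺ˡ; ∈-++⁺ʳ)
open import Data.List.Relation.Unary.Any using (here; there)
open import Data.Nat using (ℕ; zero; suc; _+_; _∸_; _⊔_; _≤_; _<_; _≤ᵇ_; _<ᵇ_; _≡ᵇ_; z≤n; s≤s)
open import Data.Nat.Properties
open import Algebra.Properties.CommutativeSemigroup +-commutativeSemigroup using (interchange)
open import Data.Product using (∃-syntax; _×_; _,_; proj₁; proj₂)
open import Data.Sum using (_⊎_; inj₁; inj₂)
open import Data.Unit using (tt)
import Data.Vec as Vec
open import Function using (_∘_)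
open import Function.Bundles using (_⇔_; mk⇔; Equivalence)
open import Function.Properties.Equivalence using () renaming (sym to ⇔-sym)
open import Relation.Binary.PropositionalEquality hiding ([_])
open import Relation.Nullary using (¬_; yes; no)

private variable A B : Set

ind : Bool → ℕ
ind b = if b then 1 else 0

T-injective : ∀ {a b} → (T a → T b) → (T b → T a) → a ≡ b
T-injective {false} {false} _ _ = refl
T-injective {false} {true}  _ g = ⊥-elim (g tt)
T-injective {true}  {false} f _ = ⊥-elim (f tt)
T-injective {true}  {true}  _ _ = refl

T-∧-intro : ∀ {a b} → T a → T b → T (a ∧ b)
T-∧-intro p q = Equivalence.from T-∧ (p , q)

T-∧-fst : ∀ {a b} → T (a ∧ b) → T a
T-∧-fst = proj₁ ∘ Equivalence.to T-∧

T-∧-snd : ∀ {a b} → T (a ∧ b) → T b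
T-∧-snd = proj₂ ∘ Equivalence.to T-∧

¬T⇒≡false : ∀ {a} → ¬ T a → a ≡ false
¬T⇒≡false {false} _ = refl
¬T⇒≡false {true}  f = ⊥-elim (f tt)

T-not-elim : ∀ {a} → T (not a) → ¬ T a
T-not-elim {a} na ta = subst T (Equivalence.to T-not-≡ na) ta

⇒ᵇ-elim : ∀ {a b} → T (a ⇒ᵇ b) → T a → T b
⇒ᵇ-elim {true} h _ = h

≡ᵇ-∧-subst : ∀ (φ : ℕ → Bool) r j → ((r ≡ᵇ j) ∧ φ j) ≡ ((r ≡ᵇ j) ∧ φ r)
≡ᵇ-∧-subst φ r j with r ≡ᵇ j in eq
... | false = refl
... | true rewrite ≡ᵇ⇒≡ r j (Equivalence.from T-≡ eq) = refl

ind-<ᵇ-suc : ∀ i k → ind (i <ᵇ suc k) ≡ ind (i <ᵇ k) + ind (i ≡ᵇ k)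
ind-<ᵇ-suc zero    zero    = refl
ind-<ᵇ-suc zero    (suc k) = refl
ind-<ᵇ-suc (suc i) zero    = refl
ind-<ᵇ-suc (suc i) (suc k) = ind-<ᵇ-suc i k

≤ᵇ≡<ᵇsuc : ∀ i k → (i ≤ᵇ k) ≡ (i <ᵇ suc k)
≤ᵇ≡<ᵇsuc zero    k = refl
≤ᵇ≡<ᵇsuc (suc i) k = refl

≡-through : ∀ {F G : A → B} → (∀ a → F a ≡ G a) → ∀ a b → G a ≡ G b → F a ≡ F b
≡-through e a b p = trans (e a) (trans p (sym (e b)))

sumBy : (A → ℕ) → List A → ℕ
sumBy f []       = 0
sumBy f (x ∷ xs) = f x + sumBy f xs

sumBy-++ : (f : A → ℕ) (xs ys : List A) → sumBy f (xs ++ ys) ≡ sumBy f xs + sumBy f ys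
sumBy-++ f []       ys = refl
sumBy-++ f (x ∷ xs) ys = trans (cong (f x +_) (sumBy-++ f xs ys)) (sym (+-assoc (f x) _ _))

sumBy-cong : {f g : A → ℕ} (xs : List A) → (∀ x → f x ≡ g x) → sumBy f xs ≡ sumBy g xs
sumBy-cong []       f≗g = refl
sumBy-cong (x ∷ xs) f≗g = cong₂ _+_ (f≗g x) (sumBy-cong xs f≗g)

sumBy-zero : {f : A → ℕ} (xs : List A) → (∀ x → f x ≡ 0) → sumBy f xs ≡ 0
sumBy-zero []       f≗0 = refl
sumBy-zero (x ∷ xs) f≗0 = cong₂ _+_ (f≗0 x) (sumBy-zero xs f≗0)

sumBy-+ : (f g : A → ℕ) (xs : List A) → sumBy (λ x → f x + g x) xs ≡ sumBy f xs + sumBy g xs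
sumBy-+ f g []       = refl
sumBy-+ f g (x ∷ xs) =
  trans (cong (f x + g x +_) (sumBy-+ f g xs)) (interchange (f x) (g x) (sumBy f xs) (sumBy g xs))

sumBy-map : (f : B → ℕ) (g : A → B) (xs : List A) → sumBy f (map g xs) ≡ sumBy (f ∘ g) xs
sumBy-map f g []       = refl
sumBy-map f g (x ∷ xs) = cong (f (g x) +_) (sumBy-map f g xs)

sumBy-concatMap : (f : B → ℕ) (h : A → List B) (xs : List A) →
  sumBy f (concatMap h xs) ≡ sumBy (sumBy f ∘ h) xs
sumBy-concatMap f h []       = refl
sumBy-concatMap f h (x ∷ xs) =
  trans (sumBy-++ f (h x) (concatMap h xs)) (cong (sumBy f (h x) +_) (sumBy-concatMap f h xs))

sumBy-filterᵇ : (q P : A → Bool) (xs : List A) →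
  sumBy (ind ∘ q) (filterᵇ P xs) ≡ sumBy (λ y → ind (q y ∧ P y)) xs
sumBy-filterᵇ q P [] = refl
sumBy-filterᵇ q P (x ∷ xs) with P x
... | true  = cong₂ _+_ (cong ind (sym (∧-identityʳ (q x)))) (sumBy-filterᵇ q P xs)
... | false = cong₂ _+_ (cong ind (sym (∧-zeroʳ (q x)))) (sumBy-filterᵇ q P xs)

sumBy-guard : (b : Bool) (f : A → Bool) (xs : List A) →
  sumBy (λ x → ind (b ∧ f x)) xs ≡ (if b then sumBy (ind ∘ f) xs else 0)
sumBy-guard true  f xs = refl
sumBy-guard false f xs = sumBy-zero xs (λ _ → refl)

module Histogram (h : A → ℕ) where

  atLeast : ℕ → List A → ℕ
  atLeast i = sumBy (λ x → ind (i ≤ᵇ h x))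

  exactly : ℕ → List A → ℕ
  exactly a = sumBy (λ x → ind (a ≡ᵇ h x))

  atLeast-suc : ∀ i xs → atLeast i xs ≡ exactly i xs + atLeast (suc i) xs
  atLeast-suc i xs =
    trans (sumBy-cong xs split) (sumBy-+ (λ x → ind (i ≡ᵇ h x)) (λ x → ind (suc i ≤ᵇ h x)) xs)
    where
    split : ∀ x → ind (i ≤ᵇ h x) ≡ ind (i ≡ᵇ h x) + ind (suc i ≤ᵇ h x)
    split x = trans (cong ind (≤ᵇ≡<ᵇsuc i (h x)))
                    (trans (ind-<ᵇ-suc i (h x)) (+-comm (ind (i <ᵇ h x)) _))

  atLeast-above : ∀ {b} → (∀ x → h x ≤ b) → ∀ i xs → b < i → atLeast i xs ≡ 0
  atLeast-above h≤b i xs b<i = sumBy-zero xs (λ x → cong ind (¬T⇒≡false (i≰hx x)))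
    where
    i≰hx : ∀ x → ¬ T (i ≤ᵇ h x)
    i≰hx x i≤hx = <⇒≱ b<i (≤-trans (≤ᵇ⇒≤ i (h x) i≤hx) (h≤b x))

  -- Downward induction on i, starting above the bound b where both sides vanish.
  atLeast-≡ : ∀ {b} → (∀ x → h x ≤ b) → ∀ xs ys →
    (∀ a → exactly a xs ≡ exactly a ys) → ∀ i → atLeast i xs ≡ atLeast i ys
  atLeast-≡ {b} h≤b xs ys exactly≡ i = go (suc b) i (<-≤-trans (n<1+n b) (m≤n+m (suc b) i))
    where
    go : ∀ d i → b < i + d → atLeast i xs ≡ atLeast i ys
    go zero    i b<i+0 = trans (atLeast-above h≤b i xs b<i) (sym (atLeast-above h≤b i ys b<i))
      where b<i = subst (b <_) (+-identityʳ i) b<i+0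
    go (suc d) i b<i+1+d =
      ≡-through (atLeast-suc i) xs ys
        (cong₂ _+_ (exactly≡ i) (go d (suc i) (subst (b <_) (+-suc i d) b<i+1+d)))

  exactly-via-atLeast : ∀ a xs → exactly a xs ≡ atLeast a xs ∸ atLeast (suc a) xs
  exactly-via-atLeast a xs =
    sym (trans (cong (_∸ atLeast (suc a) xs) (atLeast-suc a xs)) (m+n∸n≡m (exactly a xs) (atLeast (suc a) xs)))

-- Multiplicities and kernels of monomial maps

count-++ : ∀ x u v → count x (u ++ v) ≡ count x u + count x v
count-++ x []      v = refl
count-++ x (y ∷ u) v with x =ᵗ y
... | true  = cong suc (count-++ x u v)
... | false = count-++ x u v

count-map : ∀ x (h : A → TVar) xs → count x (map h xs) ≡ sumBy (λ y → ind (x =ᵗ h y)) xs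
count-map x h []       = refl
count-map x h (y ∷ ys) with x =ᵗ h y
... | true  = cong suc (count-map x h ys)
... | false = count-map x h ys

count-concatMap : ∀ x (img : A → List TVar) m →
  count x (concatMap img m) ≡ sumBy (count x ∘ img) m
count-concatMap x img []      = refl
count-concatMap x img (g ∷ m) =
  trans (count-++ x (img g) (concatMap img m)) (cong (count x (img g) +_) (count-concatMap x img m))

count-concatMap-by : ∀ {x} {img : A → List TVar} {f : A → ℕ} → (∀ g → count x (img g) ≡ f g) →
  ∀ m → count x (concatMap img m) ≡ sumBy f m
count-concatMap-by {x = x} {img} e m = trans (count-concatMap x img m) (sumBy-cong m e)

allᵇ-elim : ∀ {p : A → Bool} {xs x} → T (allᵇ p xs) → x ∈ xs → T (p x)
allᵇ-elim h (here refl) = T-∧-fst h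
allᵇ-elim h (there x∈xs) = allᵇ-elim (T-∧-snd h) x∈xs

allᵇ-intro : ∀ {p : A → Bool} xs → (∀ x → x ∈ xs → T (p x)) → T (allᵇ p xs)
allᵇ-intro []       h = tt
allᵇ-intro (x ∷ xs) h = T-∧-intro (h x (here refl)) (allᵇ-intro xs (λ y → h y ∘ there))

=ᵗ⇒≡ : ∀ {x y} → T (x =ᵗ y) → x ≡ y
=ᵗ⇒≡ {zV a b} {zV c d} t = cong₂ zV (≡ᵇ⇒≡ a c (T-∧-fst t)) (≡ᵇ⇒≡ b d (T-∧-snd t))
=ᵗ⇒≡ {zK a}   {zK b}   t = cong zK (≡ᵇ⇒≡ a b t)
=ᵗ⇒≡ {tV}     {tV}     t = refl

count≡0⊎∈ : ∀ x u → count x u ≡ 0 ⊎ x ∈ u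
count≡0⊎∈ x [] = inj₁ refl
count≡0⊎∈ x (y ∷ u) with x =ᵗ y in eq
... | true  = inj₂ (here (=ᵗ⇒≡ (Equivalence.from T-≡ eq)))
... | false with count≡0⊎∈ x u
...   | inj₁ none = inj₁ none
...   | inj₂ x∈u  = inj₂ (there x∈u)

-- sameMon only compares the variables occurring in u ++ v; any other one occurs in neither.
sameMon-sound : ∀ u v → T (sameMon u v) → ∀ x → count x u ≡ count x v
sameMon-sound u v t x with count≡0⊎∈ x u | count≡0⊎∈ x v
... | inj₂ x∈u | _        = ≡ᵇ⇒≡ _ _ (allᵇ-elim t (∈-++⁺ˡ x∈u))
... | inj₁ _   | inj₂ x∈v = ≡ᵇ⇒≡ _ _ (allᵇ-elim t (∈-++⁺ʳ u x∈v))
... | inj₁ u0  | inj₁ v0  = trans u0 (sym v0)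

sameMon-complete : ∀ u v → (∀ x → count x u ≡ count x v) → T (sameMon u v)
sameMon-complete u v h = allᵇ-intro (u ++ v) (λ x _ → ≡⇒≡ᵇ _ _ (h x))

sameMon-respʳ : ∀ u v w → T (sameMon v w) → sameMon u v ≡ sameMon u w
sameMon-respʳ u v w v~w = T-injective
  (λ u~v → sameMon-complete u w (λ x → trans (sameMon-sound u v u~v x) (sameMon-sound v w v~w x)))
  (λ u~w → sameMon-complete u v
    (λ x → trans (sameMon-sound u w u~w x) (sym (sameMon-sound v w v~w x))))

SameImage : (A → List TVar) → List A → List A → Set
SameImage img m m′ = ∀ x → count x (concatMap img m) ≡ count x (concatMap img m′)

sameMon-≡ : ∀ (img₁ img₂ : A → List TVar) m m′ → SameImage img₁ m m′ ⇔ SameImage img₂ m m′ →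
  sameMon (concatMap img₁ m) (concatMap img₁ m′) ≡ sameMon (concatMap img₂ m) (concatMap img₂ m′)
sameMon-≡ {A} img₁ img₂ m m′ same = T-injective
  (sameMon-complete (img₂* m) (img₂* m′) ∘ Equivalence.to same ∘ sameMon-sound (img₁* m) (img₁* m′))
  (sameMon-complete (img₁* m) (img₁* m′) ∘ Equivalence.from same ∘ sameMon-sound (img₂* m) (img₂* m′))
  where
  img₁* img₂* : List A → List TVar
  img₁* = concatMap img₁
  img₂* = concatMap img₂

module _ {c ℓ : Level} (K : CommutativeRing c ℓ) where
  open CommutativeRing K using (_≈_; 0#)
    renaming (_+_ to _⊕_; +-identityˡ to ⊕-identityˡ; refl to ≈-refl; trans to ≈-trans)

  coeffImg-cong : ∀ (img₁ img₂ : A → List TVar) p {u w} →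
    (∀ m → sameMon (concatMap img₁ m) u ≡ sameMon (concatMap img₂ m) w) →
    coeffImg K img₁ p u ≡ coeffImg K img₂ p w
  coeffImg-cong img₁ img₂ []            fibre = refl
  coeffImg-cong img₁ img₂ ((a , m) ∷ p) fibre =
    cong₂ _⊕_ (cong (λ b → if b then a else 0#) (fibre m)) (coeffImg-cong img₁ img₂ p fibre)

  coeffImg-≈0⊎hit : ∀ (img : A → List TVar) p u →
    coeffImg K img p u ≈ 0# ⊎ ∃[ m ] T (sameMon (concatMap img m) u)
  coeffImg-≈0⊎hit img []            u = inj₁ ≈-refl
  coeffImg-≈0⊎hit img ((a , m) ∷ p) u with sameMon (concatMap img m) u in eq
  ... | true  = inj₂ (m , Equivalence.from T-≡ eq)
  ... | false with coeffImg-≈0⊎hit img p u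
  ...   | inj₁ rest≈0 = inj₁ (≈-trans (⊕-identityˡ _) rest≈0)
  ...   | inj₂ hit    = inj₂ hit

  -- Each coefficient of img₁ p is one of img₂ p: both collect the same terms of p.
  InKer-transfer : ∀ (img₁ img₂ : A → List TVar) →
    (∀ m m′ → SameImage img₁ m m′ ⇔ SameImage img₂ m m′) →
    ∀ p → InKer K img₂ p → InKer K img₁ p
  InKer-transfer img₁ img₂ same p ker₂ u with coeffImg-≈0⊎hit img₁ p u
  ... | inj₁ coeff≈0 = coeff≈0
  ... | inj₂ (m₀ , hit) =
    subst (_≈ 0#) (sym (coeffImg-cong img₁ img₂ p fibre)) (ker₂ (concatMap img₂ m₀))
    where
    fibre : ∀ m → sameMon (concatMap img₁ m) u ≡ sameMon (concatMap img₂ m) (concatMap img₂ m₀)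
    fibre m = trans (sym (sameMon-respʳ (concatMap img₁ m) (concatMap img₁ m₀) u hit))
                    (sameMon-≡ img₁ img₂ m m₀ (same m m₀))

  InKer-⇔ : ∀ (img₁ img₂ : A → List TVar) →
    (∀ m m′ → SameImage img₁ m m′ ⇔ SameImage img₂ m m′) →
    ∀ p → InKer K img₁ p ⇔ InKer K img₂ p
  InKer-⇔ img₁ img₂ same p =
    mk⇔ (InKer-transfer img₂ img₁ (λ m m′ → ⇔-sym (same m m′)) p) (InKer-transfer img₁ img₂ same p)

range-suc : ∀ k → range (suc k) ≡ range k ++ [ suc k ]
range-suc k = trans (cong (map suc) (sym (upTo-∷ʳ k))) (map-++ suc (upTo k) [ k ])

length-range : ∀ k → length (range k) ≡ k
length-range k = trans (length-map suc (upTo k)) (length-upTo k)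

∈-range⁺ : ∀ {n x} → 1 ≤ x → x ≤ n → x ∈ range n
∈-range⁺ {x = suc x} _ x<n = ∈-map⁺ suc (∈-upTo⁺ x<n)

∈-range⁻ : ∀ {n x} → x ∈ range n → 1 ≤ x × x ≤ n
∈-range⁻ x∈ with _ , y∈ , refl ← ∈-map⁻ suc x∈ = s≤s z≤n , ∈-upTo⁻ y∈

allᵇ-range : ∀ {p : ℕ → Bool} {n x} → T (allᵇ p (range n)) → 1 ≤ x → x ≤ n → T (p x)
allᵇ-range h 1≤x x≤n = allᵇ-elim h (∈-range⁺ 1≤x x≤n)

inRange : ℕ → ℕ → Bool
inRange k r = (1 ≤ᵇ r) ∧ (r ≤ᵇ k)

ind-inRange-suc : ∀ k r → ind (inRange (suc k) r) ≡ ind (inRange k r) + ind (r ≡ᵇ suc k)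
ind-inRange-suc k zero    = refl
ind-inRange-suc k (suc r) = ind-<ᵇ-suc r k

sumBy-≡ᵇ-range : ∀ r k → sumBy (λ j → ind (r ≡ᵇ j)) (range k) ≡ ind (inRange k r)
sumBy-≡ᵇ-range zero    zero    = refl
sumBy-≡ᵇ-range (suc r) zero    = refl
sumBy-≡ᵇ-range r       (suc k) = begin
  sumBy (λ j → ind (r ≡ᵇ j)) (range (suc k))
    ≡⟨ cong (sumBy (λ j → ind (r ≡ᵇ j))) (range-suc k) ⟩
  sumBy (λ j → ind (r ≡ᵇ j)) (range k ++ [ suc k ])
    ≡⟨ sumBy-++ (λ j → ind (r ≡ᵇ j)) (range k) [ suc k ] ⟩
  sumBy (λ j → ind (r ≡ᵇ j)) (range k) + (ind (r ≡ᵇ suc k) + 0)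
    ≡⟨ cong₂ _+_ (sumBy-≡ᵇ-range r k) (+-identityʳ _) ⟩
  ind (inRange k r) + ind (r ≡ᵇ suc k)
    ≡⟨ ind-inRange-suc k r ⟨
  ind (inRange (suc k) r) ∎
  where open ≡-Reasoning

sumBy-≡ᵇ-∧-range : ∀ (φ : ℕ → Bool) r k →
  sumBy (λ j → ind ((r ≡ᵇ j) ∧ φ j)) (range k) ≡ ind (inRange k r ∧ φ r)
sumBy-≡ᵇ-∧-range φ r k =
  trans (sumBy-cong (range k) (cong ind ∘ ≡ᵇ-∧-subst φ r)) (constant-guard (φ r))
  where
  constant-guard : ∀ b → sumBy (λ j → ind ((r ≡ᵇ j) ∧ b)) (range k) ≡ ind (inRange k r ∧ b)
  constant-guard true = begin
    sumBy (λ j → ind ((r ≡ᵇ j) ∧ true)) (range k) ≡⟨ sumBy-cong (range k) (cong ind ∘ ∧-identityʳ ∘ (r ≡ᵇ_)) ⟩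
    sumBy (λ j → ind (r ≡ᵇ j)) (range k)          ≡⟨ sumBy-≡ᵇ-range r k ⟩
    ind (inRange k r)                             ≡⟨ cong ind (∧-identityʳ _) ⟨
    ind (inRange k r ∧ true)                      ∎
    where open ≡-Reasoning
  constant-guard false =
    trans (sumBy-zero (range k) (cong ind ∘ ∧-zeroʳ ∘ (r ≡ᵇ_))) (cong ind (sym (∧-zeroʳ (inRange k r))))

inRange⁻ : ∀ k r → T (inRange k r) → 1 ≤ r × r ≤ k
inRange⁻ k r t = ≤ᵇ⇒≤ 1 r (T-∧-fst t) , ≤ᵇ⇒≤ r k (T-∧-snd {1 ≤ᵇ r} t)

inRange⁺ : ∀ {k r} → 1 ≤ r → r ≤ k → T (inRange k r)
inRange⁺ 1≤r r≤k = T-∧-intro (≤⇒≤ᵇ 1≤r) (≤⇒≤ᵇ r≤k)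

ψ-diag-absurd : ∀ k r e → ¬ T (inRange k r ∧ ((r ≡ᵇ e) ∧ (k <ᵇ e)))
ψ-diag-absurd k r e t = n≮n r (≤-<-trans r≤k (subst (k <_) (sym r≡e) k<e))
  where
  r≤k = proj₂ (inRange⁻ k r (T-∧-fst t))
  r≡e = ≡ᵇ⇒≡ r e (T-∧-fst (T-∧-snd {inRange k r} t))
  k<e = <ᵇ⇒< k e (T-∧-snd (T-∧-snd {inRange k r} t))

zp : ℕ × ℕ → TVar
zp p = zV (proj₁ p) (proj₂ p)

count-map-zp : ∀ x → (∀ r s → (x =ᵗ zV r s) ≡ false) → ∀ L → count x (map zp L) ≡ 0
count-map-zp x x≢zV L = trans (count-map x zp L) (sumBy-zero L (λ p → cong ind (x≢zV (proj₁ p) (proj₂ p))))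

count-map-zp-filterᵇ : ∀ x (ok : ℕ × ℕ → Bool) L →
  count x (map zp (filterᵇ ok L)) ≡ sumBy (λ p → ind ((x =ᵗ zp p) ∧ ok p)) L
count-map-zp-filterᵇ x ok L = trans (count-map x zp (filterᵇ ok L)) (sumBy-filterᵇ (λ p → x =ᵗ zp p) ok L)

pairs : ℕ → List (ℕ × ℕ)
pairs n = concatMap (λ r → map (r ,_) (range n)) (range n)

count-zV-filterᵇ-pairs : ∀ (ok : ℕ × ℕ → Bool) n r s →
  count (zV r s) (map zp (filterᵇ ok (pairs n))) ≡ ind (inRange n r ∧ (inRange n s ∧ ok (r , s)))
count-zV-filterᵇ-pairs ok n r s = begin
  count (zV r s) (map zp (filterᵇ ok (pairs n)))
    ≡⟨ count-map-zp-filterᵇ (zV r s) ok (pairs n) ⟩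
  sumBy hit (pairs n)
    ≡⟨ sumBy-concatMap hit (λ i → map (i ,_) (range n)) (range n) ⟩
  sumBy (λ i → sumBy hit (map (i ,_) (range n))) (range n)
    ≡⟨ sumBy-cong (range n) row ⟩
  sumBy (λ i → ind ((r ≡ᵇ i) ∧ (inRange n s ∧ ok (i , s)))) (range n)
    ≡⟨ sumBy-≡ᵇ-∧-range (λ i → inRange n s ∧ ok (i , s)) r n ⟩
  ind (inRange n r ∧ (inRange n s ∧ ok (r , s))) ∎
  where
  open ≡-Reasoning
  hit : ℕ × ℕ → ℕ
  hit p = ind ((zV r s =ᵗ zp p) ∧ ok p)
  guarded : ∀ i b →
    sumBy (λ j → ind (b ∧ ((s ≡ᵇ j) ∧ ok (i , j)))) (range n) ≡ ind (b ∧ (inRange n s ∧ ok (i , s)))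
  guarded i true  = sumBy-≡ᵇ-∧-range (λ j → ok (i , j)) s n
  guarded i false = sumBy-zero (range n) (λ _ → refl)
  row : ∀ i → sumBy hit (map (i ,_) (range n)) ≡ ind ((r ≡ᵇ i) ∧ (inRange n s ∧ ok (i , s)))
  row i = trans (sumBy-map hit (i ,_) (range n))
         (trans (sumBy-cong (range n) (λ j → cong ind (∧-assoc (r ≡ᵇ i) (s ≡ᵇ j) (ok (i , j)))))
                (guarded i (r ≡ᵇ i)))

zip-map-self : ∀ (g : A → B) xs → zip xs (map g xs) ≡ map (λ x → x , g x) xs
zip-map-self g []       = refl
zip-map-self g (x ∷ xs) = cong ((x , g x) ∷_) (zip-map-self g xs)

-- Images of a single generator

inKset : ∀ {n} → Grid n → ℕ → ℕ → Bool
inKset {n} J r s = ((r ≡ᵇ s) ∧ (2 ≤ᵇ r) ∧ (r ≤ᵇ n ∸ 1) ∧ mem J r s)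
                 ∨ ((r <ᵇ s) ∧ inP n r s ∧ isMax J r s)

ψpairs : ∀ {n} → Grid n → List (ℕ × ℕ)
ψpairs J = filterᵇ (λ p → kOf J <ᵇ proj₂ p) (zip (range (length (alphaOf J))) (alphaOf J))

height : ∀ {n} → OrderIdeal n → ℕ
height = kOf ∘ proj₁

module _ {n : ℕ} where

  θgen-count-t : ∀ (g : OrderIdeal n) → count tV (θgen n g) ≡ 1
  θgen-count-t (J , _) = cong suc (count-map-zp tV (λ _ _ → refl) (Kset J))

  ψgen-count-t : ∀ (g : OrderIdeal n) → count tV (ψgen n g) ≡ 0
  ψgen-count-t (J , _) = count-map-zp tV (λ _ _ → refl) (ψpairs J)

  θgen-count-zK : ∀ a (g : OrderIdeal n) → count (zK a) (θgen n g) ≡ 0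
  θgen-count-zK a (J , _) = count-map-zp (zK a) (λ _ _ → refl) (Kset J)

  ψgen-count-zK : ∀ a (g : OrderIdeal n) → count (zK a) (ψgen n g) ≡ ind (a ≡ᵇ height g)
  ψgen-count-zK a (J , _) with a ≡ᵇ kOf J
  ... | true  = cong suc (count-map-zp (zK a) (λ _ _ → refl) (ψpairs J))
  ... | false = count-map-zp (zK a) (λ _ _ → refl) (ψpairs J)

  θgen-count-zV : ∀ (g : OrderIdeal n) r s →
    count (zV r s) (θgen n g) ≡ ind (inRange n r ∧ (inRange n s ∧ inKset (proj₁ g) r s))
  θgen-count-zV (J , _) r s = count-zV-filterᵇ-pairs (λ p → inKset J (proj₁ p) (proj₂ p)) n r s

  ψgen-count-zV : ∀ (g : OrderIdeal n) r s → let k = height g ; α = entryOf (proj₁ g) in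
    count (zV r s) (ψgen n g) ≡ ind (inRange k r ∧ ((s ≡ᵇ α r) ∧ (k <ᵇ α r)))
  ψgen-count-zV (J , _) r s = begin
    count (zV r s) (map zp (filterᵇ above (zip (range (length (alphaOf J))) (alphaOf J))))
      ≡⟨ cong (λ L → count (zV r s) (map zp (filterᵇ above L))) rows ⟩
    count (zV r s) (map zp (filterᵇ above (map (λ j → j , α j) (range k))))
      ≡⟨ count-map-zp-filterᵇ (zV r s) above (map (λ j → j , α j) (range k)) ⟩
    sumBy (λ p → ind ((zV r s =ᵗ zp p) ∧ above p)) (map (λ j → j , α j) (range k))
      ≡⟨ sumBy-map _ (λ j → j , α j) (range k) ⟩
    sumBy (λ j → ind (((r ≡ᵇ j) ∧ (s ≡ᵇ α j)) ∧ (k <ᵇ α j))) (range k)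
      ≡⟨ sumBy-cong (range k) (λ j → cong ind (∧-assoc (r ≡ᵇ j) (s ≡ᵇ α j) (k <ᵇ α j))) ⟩
    sumBy (λ j → ind ((r ≡ᵇ j) ∧ ((s ≡ᵇ α j) ∧ (k <ᵇ α j)))) (range k)
      ≡⟨ sumBy-≡ᵇ-∧-range (λ j → (s ≡ᵇ α j) ∧ (k <ᵇ α j)) r k ⟩
    ind (inRange k r ∧ ((s ≡ᵇ α r) ∧ (k <ᵇ α r))) ∎
    where
    open ≡-Reasoning
    k = kOf J
    α = entryOf J
    above : ℕ × ℕ → Bool
    above p = k <ᵇ proj₂ p
    rows : zip (range (length (alphaOf J))) (alphaOf J) ≡ map (λ j → j , α j) (range k)
    rows = trans (cong (λ l → zip (range l) (alphaOf J)) (trans (length-map α (range k)) (length-range k)))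
                 (zip-map-self α (range k))

  ψgen-count-diag : ∀ (g : OrderIdeal n) r → count (zV r r) (ψgen n g) ≡ 0
  ψgen-count-diag g r =
    trans (ψgen-count-zV g r r) (cong ind (¬T⇒≡false (ψ-diag-absurd (height g) r (entryOf (proj₁ g) r))))

-- Order ideals

at-replicate-false : ∀ k s → ¬ T (at (Vec.replicate k false) s)
at-replicate-false (suc k) (suc (suc s)) = at-replicate-false k (suc s)

at-bounds : ∀ {m} (v : Vec.Vec Bool m) s → T (at v s) → 1 ≤ s × s ≤ m
at-bounds (x Vec.∷ v) (suc zero)    _ = s≤s z≤n , s≤s z≤n
at-bounds (x Vec.∷ v) (suc (suc s)) t = s≤s z≤n , s≤s (proj₂ (at-bounds v (suc s) t))

atV-bounds : ∀ {m k} (J : Vec.Vec (Vec.Vec Bool k) m) r s → T (at (atV J r) s) → 1 ≤ r × r ≤ m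
atV-bounds {k = k} Vec.[]  r       s t = ⊥-elim (at-replicate-false k s t)
atV-bounds {k = k} (_ Vec.∷ J) zero    s t = ⊥-elim (at-replicate-false k s t)
atV-bounds (_ Vec.∷ J) (suc zero)    s t = s≤s z≤n , s≤s z≤n
atV-bounds (_ Vec.∷ J) (suc (suc r)) s t = s≤s z≤n , s≤s (proj₂ (atV-bounds J (suc r) s t))

mem-bounds : ∀ {n} (J : Grid n) r s → T (mem J r s) → (1 ≤ r × r ≤ n) × (1 ≤ s × s ≤ n)
mem-bounds J r s t = atV-bounds J r s t , at-bounds (atV J r) s t

inP-bounds : ∀ n r s → T (inP n r s) → (1 ≤ r × r ≤ n) × (1 ≤ s × s ≤ n)
inP-bounds n r s t = (1≤r , ≤-trans r≤s s≤n) , (≤-trans 1≤r r≤s , s≤n)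
  where
  1≤r = ≤ᵇ⇒≤ 1 r (T-∧-fst t)
  r≤s = ≤ᵇ⇒≤ r s (T-∧-fst (T-∧-snd {1 ≤ᵇ r} t))
  s≤n = ≤ᵇ⇒≤ s n (T-∧-fst (T-∧-snd {r ≤ᵇ s} (T-∧-snd {1 ≤ᵇ r} t)))

≢⇒not-≡ᵇ∧≡ᵇ : ∀ {r m} → r ≢ m → T (not ((r ≡ᵇ m) ∧ (r ≡ᵇ m)))
≢⇒not-≡ᵇ∧≡ᵇ {r} {m} r≢m = Equivalence.from T-not-≡ (¬T⇒≡false (r≢m ∘ ≡ᵇ⇒≡ r m ∘ T-∧-fst))

inP-diag : ∀ {n r} → 2 ≤ r → r < n → T (inP n r r)
inP-diag {n} {r} 2≤r r<n =
  T-∧-intro (≤⇒≤ᵇ (≤-trans (s≤s z≤n) 2≤r)) (T-∧-intro (≤⇒≤ᵇ (≤-refl {r})) (T-∧-intro (≤⇒≤ᵇ (<⇒≤ r<n))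
    (T-∧-intro (≢⇒not-≡ᵇ∧≡ᵇ (>⇒≢ 2≤r)) (≢⇒not-≡ᵇ∧≡ᵇ (<⇒≢ r<n)))))

inP-diag⇒<n : ∀ n r → T (inP n r r) → r < n
inP-diag⇒<n n r t = ≤∧≢⇒< (proj₂ (proj₁ (inP-bounds n r r t))) (λ r≡n → T-not-elim corner (r,r≡n,n r≡n))
  where
  corner = T-∧-snd {not ((r ≡ᵇ 1) ∧ (r ≡ᵇ 1))} (T-∧-snd {r ≤ᵇ n} (T-∧-snd {r ≤ᵇ r} (T-∧-snd {1 ≤ᵇ r} t)))
  r,r≡n,n : r ≡ n → T ((r ≡ᵇ n) ∧ (r ≡ᵇ n))
  r,r≡n,n r≡n = T-∧-intro (≡⇒≡ᵇ r n r≡n) (≡⇒≡ᵇ r n r≡n)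

-- kOf J unfolds to largestOr1 (λ l → mem J l l) (range n),
-- and entryOf J r to firstOr (isMax J r) r (range n).
largestOr1 : (ℕ → Bool) → List ℕ → ℕ
largestOr1 P = foldr (λ l acc → if P l then l ⊔ acc else acc) 1

largestOr1-≥1 : ∀ P L → 1 ≤ largestOr1 P L
largestOr1-≥1 P []      = ≤-refl
largestOr1-≥1 P (x ∷ L) with P x
... | true  = ≤-trans (largestOr1-≥1 P L) (m≤n⊔m x _)
... | false = largestOr1-≥1 P L

largestOr1-upper : ∀ (P : ℕ → Bool) L {x} → x ∈ L → T (P x) → x ≤ largestOr1 P L
largestOr1-upper P (y ∷ L) (here refl) t with P y
... | true = m≤m⊔n y _
largestOr1-upper P (y ∷ L) (there x∈L) t with P y
... | true  = ≤-trans (largestOr1-upper P L x∈L t) (m≤n⊔m y _)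
... | false = largestOr1-upper P L x∈L t

largestOr1-lub : ∀ P L {b} → (∀ x → x ∈ L → x ≤ b) → 1 ≤ b → largestOr1 P L ≤ b
largestOr1-lub P []      L≤b 1≤b = 1≤b
largestOr1-lub P (x ∷ L) L≤b 1≤b with P x
... | true  = ⊔-lub (L≤b x (here refl)) (largestOr1-lub P L (λ y → L≤b y ∘ there) 1≤b)
... | false = largestOr1-lub P L (λ y → L≤b y ∘ there) 1≤b

largestOr1-attained : ∀ P L → largestOr1 P L ≡ 1 ⊎ T (P (largestOr1 P L))
largestOr1-attained P []      = inj₁ refl
largestOr1-attained P (x ∷ L) with P x in eq
... | false = largestOr1-attained P L
... | true with ⊔-sel x (largestOr1 P L)
...   | inj₁ x⊔L≡x rewrite x⊔L≡x = inj₂ (Equivalence.from T-≡ eq)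
...   | inj₂ x⊔L≡L rewrite x⊔L≡L = largestOr1-attained P L

firstOr : (ℕ → Bool) → ℕ → List ℕ → ℕ
firstOr P d = foldr (λ t acc → if P t then t else acc) d

firstOr-default⊎sat : ∀ P d L → firstOr P d L ≡ d ⊎ T (P (firstOr P d L))
firstOr-default⊎sat P d []      = inj₁ refl
firstOr-default⊎sat P d (x ∷ L) with P x in eq
... | true  = inj₂ (Equivalence.from T-≡ eq)
... | false = firstOr-default⊎sat P d L

firstOr-sat : ∀ (P : ℕ → Bool) d L {x} → x ∈ L → T (P x) → T (P (firstOr P d L))
firstOr-sat P d (y ∷ L) x∈L t with P y in eq | x∈L
... | true  | _           = Equivalence.from T-≡ eq
... | false | here refl   = ⊥-elim (subst T eq t)
... | false | there x∈L′ = firstOr-sat P d L x∈L′ t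

module OrderIdealProperties {n : ℕ} (J : Grid n) (isIdeal : T (isOrderIdeal n J)) where

  k : ℕ
  k = kOf J

  α : ℕ → ℕ
  α = entryOf J

  mem⇒inP : ∀ {r s} → T (mem J r s) → T (inP n r s)
  mem⇒inP {r} {s} r,s∈J with (1≤r , r≤n) , (1≤s , s≤n) ← mem-bounds J r s r,s∈J =
    ⇒ᵇ-elim (allᵇ-range (allᵇ-range (T-∧-fst isIdeal) 1≤r r≤n) 1≤s s≤n) r,s∈J

  mem-downward : ∀ {r s u v} → T (mem J u v) → T (inP n r s) → r ≤ u → s ≤ v → T (mem J r s)
  mem-downward {r} {s} {u} {v} u,v∈J r,s∈P r≤u s≤v
    with (1≤r , r≤n) , (1≤s , s≤n) ← inP-bounds n r s r,s∈P
       | (1≤u , u≤n) , (1≤v , v≤n) ← mem-bounds J u v u,v∈J =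
    ⇒ᵇ-elim (allᵇ-range (allᵇ-range (allᵇ-range (allᵇ-range downClosed 1≤r r≤n) 1≤s s≤n) 1≤u u≤n) 1≤v v≤n)
            (T-∧-intro u,v∈J (T-∧-intro r,s∈P (T-∧-intro (≤⇒≤ᵇ r≤u) (≤⇒≤ᵇ s≤v))))
    where
    downClosed = T-∧-snd {allᵇ (λ r → allᵇ (λ s → mem J r s ⇒ᵇ inP n r s) (range n)) (range n)} isIdeal

  isMax-maximal : ∀ {r s u v} → T (isMax J r s) → T (mem J u v) → r ≤ u → s ≤ v → u ≡ r × v ≡ s
  isMax-maximal {r} {s} {u} {v} max u,v∈J r≤u s≤v
    with (1≤u , u≤n) , (1≤v , v≤n) ← mem-bounds J u v u,v∈J =
    ≡ᵇ⇒≡ u r (T-∧-fst same) , ≡ᵇ⇒≡ v s (T-∧-snd {u ≡ᵇ r} same)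
    where
    same = ⇒ᵇ-elim (allᵇ-range (allᵇ-range (T-∧-snd {mem J r s} max) 1≤u u≤n) 1≤v v≤n)
                   (T-∧-intro u,v∈J (T-∧-intro (≤⇒≤ᵇ r≤u) (≤⇒≤ᵇ s≤v)))

  1≤k : 1 ≤ k
  1≤k = largestOr1-≥1 (λ l → mem J l l) (range n)

  k≤n : 1 ≤ n → k ≤ n
  k≤n 1≤n = largestOr1-lub (λ l → mem J l l) (range n) (λ _ → proj₂ ∘ ∈-range⁻) 1≤n

  diag⇒≤k : ∀ {l} → T (mem J l l) → l ≤ k
  diag⇒≤k {l} l,l∈J with (1≤l , l≤n) , _ ← mem-bounds J l l l,l∈J =
    largestOr1-upper (λ l → mem J l l) (range n) (∈-range⁺ 1≤l l≤n) l,l∈J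

  k,k∈J : 2 ≤ k → T (mem J k k)
  k,k∈J 2≤k with largestOr1-attained (λ l → mem J l l) (range n)
  ... | inj₁ k≡1    = ⊥-elim (>⇒≢ 2≤k k≡1)
  ... | inj₂ k,k∈J′ = k,k∈J′

  k<n : 2 ≤ k → k < n
  k<n 2≤k = inP-diag⇒<n n k (mem⇒inP (k,k∈J 2≤k))

  diag∈J : ∀ {r} → 2 ≤ r → r ≤ k → T (mem J r r)
  diag∈J 2≤r r≤k = mem-downward (k,k∈J 2≤k) (inP-diag 2≤r (≤-<-trans r≤k (k<n 2≤k))) r≤k r≤k
    where 2≤k = ≤-trans 2≤r r≤k

  isMax-functional : ∀ {r s t} → T (isMax J r s) → T (isMax J r t) → s ≡ t
  isMax-functional {r} {s} {t} r,s-max r,t-max with ≤-total s t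
  ... | inj₁ s≤t = sym (proj₂ (isMax-maximal r,s-max (T-∧-fst r,t-max) ≤-refl s≤t))
  ... | inj₂ t≤s = proj₂ (isMax-maximal r,t-max (T-∧-fst r,s-max) ≤-refl t≤s)

  α-isMax : ∀ {r s} → T (isMax J r s) → α r ≡ s
  α-isMax {r} {s} r,s-max with _ , (1≤s , s≤n) ← mem-bounds J r s (T-∧-fst r,s-max) =
    isMax-functional (firstOr-sat (isMax J r) r (range n) (∈-range⁺ 1≤s s≤n) r,s-max) r,s-max

  α≡id⊎isMax : ∀ r → α r ≡ r ⊎ T (isMax J r (α r))
  α≡id⊎isMax r = firstOr-default⊎sat (isMax J r) r (range n)

  -- If s ≤ k then (s, s) ∈ J lies above (r, s); if r ≥ 2 then (r, r) ∈ J lies below it.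
  isMax-offdiag-straddles : ∀ {r s} → T (isMax J r s) → r < s → r ≤ k × k < s
  isMax-offdiag-straddles {r} {s} r,s-max r<s = r≤k , k<s
    where
    r,s∈J = T-∧-fst r,s-max
    s≤n = proj₂ (proj₂ (mem-bounds J r s r,s∈J))
    r≤k : r ≤ k
    r≤k with 2 ≤? r
    ... | no  r≱2 = ≤-trans (≤-pred (≰⇒> r≱2)) 1≤k
    ... | yes 2≤r = diag⇒≤k (mem-downward r,s∈J (inP-diag 2≤r (<-≤-trans r<s s≤n)) ≤-refl (<⇒≤ r<s))
    k<s : k < s
    k<s with s ≤? k
    ... | no  s≰k = ≰⇒> s≰k
    ... | yes s≤k = ⊥-elim (<⇒≢ r<s (sym (proj₁ (isMax-maximal r,s-max s,s∈J (<⇒≤ r<s) ≤-refl))))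
      where s,s∈J = diag∈J (≤-trans (s≤s (proj₁ (proj₁ (mem-bounds J r s r,s∈J)))) r<s) s≤k

  Kset-offdiag : ∀ {r s} → r ≢ s →
    (inRange n r ∧ (inRange n s ∧ inKset J r s)) ≡ (inRange k r ∧ ((s ≡ᵇ α r) ∧ (k <ᵇ α r)))
  Kset-offdiag {r} {s} r≢s = T-injective to from
    where
    to : T (inRange n r ∧ (inRange n s ∧ inKset J r s)) → T (inRange k r ∧ ((s ≡ᵇ α r) ∧ (k <ᵇ α r)))
    to t with Equivalence.to T-∨ (T-∧-snd {inRange n s} (T-∧-snd {inRange n r} t))
    ... | inj₁ diag    = ⊥-elim (r≢s (≡ᵇ⇒≡ r s (T-∧-fst diag)))
    ... | inj₂ offdiag =
      T-∧-intro (inRange⁺ (proj₁ (inRange⁻ n r (T-∧-fst t))) r≤k)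
                (T-∧-intro (≡⇒≡ᵇ s (α r) (sym αr≡s)) (<⇒<ᵇ (subst (k <_) (sym αr≡s) k<s)))
      where
      r<s = <ᵇ⇒< r s (T-∧-fst offdiag)
      r,s-max = T-∧-snd {inP n r s} (T-∧-snd {r <ᵇ s} offdiag)
      r≤k = proj₁ (isMax-offdiag-straddles r,s-max r<s)
      k<s = proj₂ (isMax-offdiag-straddles r,s-max r<s)
      αr≡s = α-isMax r,s-max
    from : T (inRange k r ∧ ((s ≡ᵇ α r) ∧ (k <ᵇ α r))) → T (inRange n r ∧ (inRange n s ∧ inKset J r s))
    from t with α≡id⊎isMax r
    ... | inj₁ αr≡r    = ⊥-elim (n≮n r (≤-<-trans r≤k (subst (k <_) αr≡r k<αr)))
      where
      r≤k = proj₂ (inRange⁻ k r (T-∧-fst t))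
      k<αr = <ᵇ⇒< k (α r) (T-∧-snd (T-∧-snd {inRange k r} t))
    ... | inj₂ r,αr-max =
      T-∧-intro (inRange⁺ 1≤r r≤n) (T-∧-intro (inRange⁺ 1≤s s≤n)
        (Equivalence.from T-∨ (inj₂ (T-∧-intro (<⇒<ᵇ r<s) (T-∧-intro (mem⇒inP r,s∈J) r,s-max)))))
      where
      r≤k = proj₂ (inRange⁻ k r (T-∧-fst t))
      s≡αr = ≡ᵇ⇒≡ s (α r) (T-∧-fst (T-∧-snd {inRange k r} t))
      k<αr = <ᵇ⇒< k (α r) (T-∧-snd (T-∧-snd {inRange k r} t))
      r,s-max = subst (T ∘ isMax J r) (sym s≡αr) r,αr-max
      r,s∈J = T-∧-fst r,s-max
      r<s = ≤-<-trans r≤k (subst (k <_) (sym s≡αr) k<αr)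
      1≤r = proj₁ (proj₁ (mem-bounds J r s r,s∈J))
      r≤n = proj₂ (proj₁ (mem-bounds J r s r,s∈J))
      1≤s = proj₁ (proj₂ (mem-bounds J r s r,s∈J))
      s≤n = proj₂ (proj₂ (mem-bounds J r s r,s∈J))

  Kset-diag : ∀ r → (inRange n r ∧ (inRange n r ∧ inKset J r r)) ≡ ((2 ≤ᵇ r) ∧ (r ≤ᵇ k))
  Kset-diag r = T-injective to from
    where
    to : T (inRange n r ∧ (inRange n r ∧ inKset J r r)) → T ((2 ≤ᵇ r) ∧ (r ≤ᵇ k))
    to t with Equivalence.to T-∨ (T-∧-snd {inRange n r} (T-∧-snd {inRange n r} t))
    ... | inj₁ diag    = T-∧-intro 2≤ᵇr (≤⇒≤ᵇ (diag⇒≤k r,r∈J))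
      where
      2≤ᵇr = T-∧-fst (T-∧-snd {r ≡ᵇ r} diag)
      r,r∈J = T-∧-snd {r ≤ᵇ n ∸ 1} (T-∧-snd {2 ≤ᵇ r} (T-∧-snd {r ≡ᵇ r} diag))
    ... | inj₂ offdiag = ⊥-elim (n≮n r (<ᵇ⇒< r r (T-∧-fst offdiag)))
    from : T ((2 ≤ᵇ r) ∧ (r ≤ᵇ k)) → T (inRange n r ∧ (inRange n r ∧ inKset J r r))
    from t = T-∧-intro r∈[1,n] (T-∧-intro r∈[1,n] (Equivalence.from T-∨ (inj₁
               (T-∧-intro (≡⇒≡ᵇ r r refl) (T-∧-intro (≤⇒≤ᵇ 2≤r)
                 (T-∧-intro (≤⇒≤ᵇ (∸-monoˡ-≤ 1 r<n)) (diag∈J 2≤r r≤k)))))))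
      where
      2≤r = ≤ᵇ⇒≤ 2 r (T-∧-fst t)
      r≤k = ≤ᵇ⇒≤ r k (T-∧-snd {2 ≤ᵇ r} t)
      r<n = ≤-<-trans r≤k (k<n (≤-trans 2≤r r≤k))
      r∈[1,n] = inRange⁺ (≤-trans (s≤s z≤n) 2≤r) (<⇒≤ r<n)

module _ {n : ℕ} where

  height≥1 : ∀ (g : OrderIdeal n) → 1 ≤ height g
  height≥1 (J , isIdeal) = OrderIdealProperties.1≤k J isIdeal

  height≤n : 1 ≤ n → ∀ (g : OrderIdeal n) → height g ≤ n
  height≤n 1≤n (J , isIdeal) = OrderIdealProperties.k≤n J isIdeal 1≤n

  θgen-count-diag : ∀ (g : OrderIdeal n) r → count (zV r r) (θgen n g) ≡ ind ((2 ≤ᵇ r) ∧ (r ≤ᵇ height g))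
  θgen-count-diag g@(J , isIdeal) r =
    trans (θgen-count-zV g r r) (cong ind (OrderIdealProperties.Kset-diag J isIdeal r))

  θgen≡ψgen-count-offdiag : ∀ (g : OrderIdeal n) {r s} → r ≢ s →
    count (zV r s) (θgen n g) ≡ count (zV r s) (ψgen n g)
  θgen≡ψgen-count-offdiag g@(J , isIdeal) {r} {s} r≢s =
    trans (θgen-count-zV g r s)
          (trans (cong ind (OrderIdealProperties.Kset-offdiag J isIdeal r≢s)) (sym (ψgen-count-zV g r s)))

-- Images of monomials

module _ {n : ℕ} where
  open Histogram (height {n})

  θ*-count-t : ∀ m → count tV (concatMap (θgen n) m) ≡ atLeast 0 m
  θ*-count-t = count-concatMap-by θgen-count-t

  ψ*-count-t : ∀ m → count tV (concatMap (ψgen n) m) ≡ 0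
  ψ*-count-t m = trans (count-concatMap-by ψgen-count-t m) (sumBy-zero m (λ _ → refl))

  θ*-count-zK : ∀ a m → count (zK a) (concatMap (θgen n) m) ≡ 0
  θ*-count-zK a m = trans (count-concatMap-by (θgen-count-zK a) m) (sumBy-zero m (λ _ → refl))

  ψ*-count-zK : ∀ a m → count (zK a) (concatMap (ψgen n) m) ≡ exactly a m
  ψ*-count-zK a = count-concatMap-by (ψgen-count-zK a)

  θ*-count-diag : ∀ r m → count (zV r r) (concatMap (θgen n) m) ≡ (if 2 ≤ᵇ r then atLeast r m else 0)
  θ*-count-diag r m =
    trans (count-concatMap-by (λ g → θgen-count-diag g r) m) (sumBy-guard (2 ≤ᵇ r) (λ g → r ≤ᵇ height g) m)

  ψ*-count-diag : ∀ r m → count (zV r r) (concatMap (ψgen n) m) ≡ 0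
  ψ*-count-diag r m = trans (count-concatMap-by (λ g → ψgen-count-diag g r) m) (sumBy-zero m (λ _ → refl))

  θ*≡ψ*-count-offdiag : ∀ {r s} → r ≢ s → ∀ m →
    count (zV r s) (concatMap (θgen n) m) ≡ count (zV r s) (concatMap (ψgen n) m)
  θ*≡ψ*-count-offdiag {r} {s} r≢s m =
    trans (count-concatMap-by (λ g → θgen≡ψgen-count-offdiag g r≢s) m)
          (sym (count-concatMap (zV r s) (ψgen n) m))

  atLeast≡-of-ψ : 1 ≤ n → ∀ m₁ m₂ → SameImage (ψgen n) m₁ m₂ → ∀ i → atLeast i m₁ ≡ atLeast i m₂
  atLeast≡-of-ψ 1≤n m₁ m₂ same =
    atLeast-≡ (height≤n 1≤n) m₁ m₂ (λ a → ≡-through (sym ∘ ψ*-count-zK a) m₁ m₂ (same (zK a)))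

  atLeast≡-of-θ : ∀ m₁ m₂ → SameImage (θgen n) m₁ m₂ → ∀ i → atLeast i m₁ ≡ atLeast i m₂
  atLeast≡-of-θ m₁ m₂ same zero          = ≡-through (sym ∘ θ*-count-t) m₁ m₂ (same tV)
  atLeast≡-of-θ m₁ m₂ same (suc zero)    = ≡-through atLeast1≡atLeast0 m₁ m₂ (atLeast≡-of-θ m₁ m₂ same 0)
    where
    atLeast1≡atLeast0 : ∀ m → atLeast 1 m ≡ atLeast 0 m
    atLeast1≡atLeast0 m = sumBy-cong m (λ g → cong ind (Equivalence.to T-≡ (≤⇒≤ᵇ (height≥1 g))))
  atLeast≡-of-θ m₁ m₂ same (suc (suc j)) =
    ≡-through (sym ∘ θ*-count-diag (suc (suc j))) m₁ m₂ (same (zV (suc (suc j)) (suc (suc j))))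

  sameImage-ψ⇒θ : 1 ≤ n → ∀ m₁ m₂ → SameImage (ψgen n) m₁ m₂ → SameImage (θgen n) m₁ m₂
  sameImage-ψ⇒θ 1≤n m₁ m₂ same tV     = ≡-through θ*-count-t m₁ m₂ (atLeast≡-of-ψ 1≤n m₁ m₂ same 0)
  sameImage-ψ⇒θ 1≤n m₁ m₂ same (zK a) = ≡-through (θ*-count-zK a) m₁ m₂ refl
  sameImage-ψ⇒θ 1≤n m₁ m₂ same (zV r s) with r ≟ s
  ... | yes refl =
    ≡-through (θ*-count-diag r) m₁ m₂ (cong (λ c → if 2 ≤ᵇ r then c else 0) (atLeast≡-of-ψ 1≤n m₁ m₂ same r))
  ... | no  r≢s  = ≡-through (θ*≡ψ*-count-offdiag r≢s) m₁ m₂ (same (zV r s))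

  sameImage-θ⇒ψ : ∀ m₁ m₂ → SameImage (θgen n) m₁ m₂ → SameImage (ψgen n) m₁ m₂
  sameImage-θ⇒ψ m₁ m₂ same tV     = ≡-through ψ*-count-t m₁ m₂ refl
  sameImage-θ⇒ψ m₁ m₂ same (zK a) =
    ≡-through (λ m → trans (ψ*-count-zK a m) (exactly-via-atLeast a m)) m₁ m₂
              (cong₂ _∸_ (atLeast≡-of-θ m₁ m₂ same a) (atLeast≡-of-θ m₁ m₂ same (suc a)))
  sameImage-θ⇒ψ m₁ m₂ same (zV r s) with r ≟ s
  ... | yes refl = ≡-through (ψ*-count-diag r) m₁ m₂ refl
  ... | no  r≢s  = ≡-through (sym ∘ θ*≡ψ*-count-offdiag r≢s) m₁ m₂ (same (zV r s))

theorem6p9 : {c ℓ : Level} (K : CommutativeRing c ℓ) (n : ℕ) → 2 ≤ n →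
    (p : Poly K (OrderIdeal n)) → InKer K (ψgen n) p ⇔ InKer K (θgen n) p
theorem6p9 K n 2≤n =
  InKer-⇔ K (ψgen n) (θgen n) (λ m₁ m₂ → mk⇔ (sameImage-ψ⇒θ 1≤n m₁ m₂) (sameImage-θ⇒ψ m₁ m₂))
  where 1≤n = ≤-trans (s≤s z≤n) 2≤n
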